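{- Let $n>1$ and $m$ be positive integers with $1<m<n$ and $n/m=p$, where $p$ is a prime number. Then $n$ can be expressed as the sum of $m$ primes, and for every integer $z\ge 0$, $$Y_{p(z)}(m,m\cdot p)=Y_{p(z+1)}(m+1,(m+1)\cdot p).$$
   Context: For a prime $p$ and positive integers $m$ and $z\ge 0$, let $S^{p(z)}_{m|mp}$ be the set of $m$-tuples $(p_1,\dots,p_m)$ of prime numbers with $p_1\le p_2\le\dots\le p_m$ and $\sum_{i=1}^m p_i=mp$ in which the prime $p$ occurs exactly $z$ times among $p_1,\dots,p_m$. Define $Y_{p(z)}(m,m\cdot p)$ to be the cardinality of $S^{p(z)}_{m|mp}$. -}

module Defs where

open import Data.Nat using (ℕ; zero; suc; _+_; _*_; _≤_; _<_; _≤?_; _≟_)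
open import Data.Nat.Primality using (Prime; prime?)
open import Data.Vec using (Vec; []; _∷_; sum; count)
open import Data.Vec.Relation.Unary.All using (All; all?)
open import Data.List using (List; []; _∷_; length; filter; concatMap; map; upTo)
open import Data.Unit using (⊤; tt)
open import Data.Product using (_×_; _,_)
open import Relation.Nullary using (Dec; yes; no)
open import Relation.Nullary.Decidable using (_×-dec_)
open import Relation.Binary.PropositionalEquality using (_≡_)

NonDecr : ∀ {m} → Vec ℕ m → Set
NonDecr [] = ⊤
NonDecr (x ∷ []) = ⊤
NonDecr (x ∷ y ∷ xs) = x ≤ y × NonDecr (y ∷ xs)

nonDecr? : ∀ {m} (v : Vec ℕ m) → Dec (NonDecr v)
nonDecr? [] = yes tt
nonDecr? (x ∷ []) = yes tt
nonDecr? (x ∷ y ∷ xs) = (x ≤? y) ×-dec nonDecr? (y ∷ xs)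

occ : ∀ {m} → ℕ → Vec ℕ m → ℕ
occ p v = count (_≟ p) v

InS : (p z m : ℕ) → Vec ℕ m → Set
InS p z m v = All Prime v × NonDecr v × sum v ≡ m * p × occ p v ≡ z

inS? : (p z m : ℕ) (v : Vec ℕ m) → Dec (InS p z m v)
inS? p z m v =
  all? prime? v ×-dec (nonDecr? v ×-dec ((sum v ≟ m * p) ×-dec (occ p v ≟ z)))

-- all vectors of length m with entries < B (a finite superset of S when B > mp)
allVecs : (m B : ℕ) → List (Vec ℕ m)
allVecs zero B = [] ∷ []
allVecs (suc m) B = concatMap (λ x → map (x ∷_) (allVecs m B)) (upTo B)

-- Y_{p(z)}(m, m·p) = |S^{p(z)}_{m|mp}|; every element of S has entries ≤ mp,
-- so it suffices to enumerate vectors with entries < mp + 1.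
Y : (p z m : ℕ) → ℕ
Y p z m = length (filter (inS? p z m) (allVecs m (suc (m * p))))

{-# OPTIONS --safe #-}
-- The constant tuple (p, …, p) shows that m·p is a sum of m primes. For the
-- counting identity, inserting one more p at its sorted position maps
-- S^{p(z)}_{m|mp} into S^{p(z+1)}_{m+1|(m+1)p}, and deleting the first p is an
-- inverse: every tuple of the target contains p, and re-inserting p into a
-- sorted tuple puts it back where it was removed. Y counts a duplicate-free
-- enumeration, so a bijection of the solution sets gives equal counts.
module Submission where

open import Defs
open import Data.Nat using (ℕ; zero; suc; _*_; _+_; _<_; _≤_; _≤?_; _≟_; z≤n; s≤s)
open import Data.Nat.Properties
  using (≤-refl; ≤-trans; ≤-antisym; <⇒≤; ≰⇒>; m≤m+n; m≤n+m; +-comm; +-cancelˡ-≡;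
         suc-injective; +-commutativeSemigroup)
open import Algebra.Properties.CommutativeSemigroup +-commutativeSemigroup using (x∙yz≈y∙xz)
open import Data.Nat.Primality using (Prime)
open import Data.Vec using (Vec; []; _∷_; sum; replicate)
open import Data.Vec.Relation.Unary.All using (All; []; _∷_) renaming (map to All-map)
open import Data.List using (List; []; _∷_; _++_; length; filter; concatMap; map; upTo; cartesianProductWith)
open import Data.List.Properties using (length-map)
open import Data.List.Membership.Propositional using (_∈_)
open import Data.List.Membership.Propositional.Properties
  using (∈-map⁺; ∈-map⁻; ∈-concatMap⁺; ∈-upTo⁺; ∈-filter⁺; ∈-filter⁻)
open import Data.List.Membership.Propositional.Properties.WithK using (unique∧set⇒bag)
open import Data.List.Relation.Unary.Any using (here) renaming (map to Any-map)
open import Data.List.Relation.Unary.Unique.Propositional using (Unique)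
open import Data.List.Relation.Unary.Unique.Propositional.Properties
  using (cartesianProductWith⁺; upTo⁺; filter⁺) renaming (map⁺ to Unique-map⁺)
open import Data.List.Relation.Binary.BagAndSetEquality using (_∼[_]_; set; ∼bag⇒↭)
open import Data.List.Relation.Binary.Permutation.Propositional.Properties using (↭-length)
open import Data.List.Relation.Unary.All using ([])
open import Data.List.Relation.Unary.AllPairs using ([]; _∷_)
open import Data.Product using (Σ; _×_; _,_; proj₂)
open import Data.Empty using (⊥-elim)
open import Data.Unit using (tt)
open import Function.Base using (_∘_)
open import Function.Bundles using (mk⇔)
open import Relation.Nullary using (yes; no)
open import Relation.Nullary.Decidable using (dec-true; dec-false)
open import Relation.Binary.PropositionalEquality
  using (_≡_; _≢_; refl; sym; trans; cong; subst; subst₂; module ≡-Reasoning)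

unique-∼set⇒length-≡ : ∀ {A : Set} {xs ys : List A} →
  Unique xs → Unique ys → xs ∼[ set ] ys → length xs ≡ length ys
unique-∼set⇒length-≡ uxs uys xs≈ys = ↭-length (∼bag⇒↭ (unique∧set⇒bag uxs uys xs≈ys))

concatMap-∷≡cartesianProductWith : ∀ {m} (xs : List ℕ) (vs : List (Vec ℕ m)) →
  concatMap (λ x → map (x ∷_) vs) xs ≡ cartesianProductWith _∷_ xs vs
concatMap-∷≡cartesianProductWith [] vs = refl
concatMap-∷≡cartesianProductWith (x ∷ xs) vs =
  cong (map (x ∷_) vs ++_) (concatMap-∷≡cartesianProductWith xs vs)

∷-injective : ∀ {m} {x y : ℕ} {xs ys : Vec ℕ m} → x ∷ xs ≡ y ∷ ys → x ≡ y × xs ≡ ys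
∷-injective refl = refl , refl

allVecs-unique : ∀ m B → Unique (allVecs m B)
allVecs-unique zero B = [] ∷ []
allVecs-unique (suc m) B
  rewrite concatMap-∷≡cartesianProductWith (upTo B) (allVecs m B) =
  cartesianProductWith⁺ _∷_ ∷-injective (upTo⁺ B) (allVecs-unique m B)

allVecs-complete : ∀ {m} B (v : Vec ℕ m) → All (_< B) v → v ∈ allVecs m B
allVecs-complete B [] [] = here refl
allVecs-complete {suc m} B (x ∷ xs) (x<B ∷ xs<B) =
  ∈-concatMap⁺ (λ y → map (y ∷_) (allVecs m B))
    (Any-map (λ { refl → ∈-map⁺ (x ∷_) (allVecs-complete B xs xs<B) }) (∈-upTo⁺ x<B))

All-≤-sum : ∀ {m} (v : Vec ℕ m) → All (_≤ sum v) v
All-≤-sum [] = []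
All-≤-sum (x ∷ xs) =
  m≤m+n x (sum xs) ∷ All-map (λ y≤ → ≤-trans y≤ (m≤n+m (sum xs) x)) (All-≤-sum xs)

sum-replicate : ∀ m p → sum (replicate m p) ≡ m * p
sum-replicate zero p = refl
sum-replicate (suc m) p = cong (p +_) (sum-replicate m p)

All-replicate : ∀ {P : ℕ → Set} m {p} → P p → All P (replicate m p)
All-replicate zero pp = []
All-replicate (suc m) pp = pp ∷ All-replicate m pp

module _ (p : ℕ) where

  occ-here : ∀ {m} (w : Vec ℕ m) → occ p (p ∷ w) ≡ suc (occ p w)
  occ-here w rewrite dec-true (p ≟ p) refl = refl

  occ-there : ∀ {m} {x} (w : Vec ℕ m) → x ≢ p → occ p (x ∷ w) ≡ occ p w
  occ-there {x = x} w x≢p rewrite dec-false (x ≟ p) x≢p = refl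

  insert : ∀ {m} → Vec ℕ m → Vec ℕ (suc m)
  insert [] = p ∷ []
  insert (x ∷ xs) with p ≤? x
  ... | yes _ = p ∷ x ∷ xs
  ... | no _ = x ∷ insert xs

  delete : ∀ {m} → Vec ℕ (suc m) → Vec ℕ m
  delete (x ∷ []) = []
  delete (x ∷ y ∷ xs) with x ≟ p
  ... | yes _ = y ∷ xs
  ... | no _ = x ∷ delete (y ∷ xs)

  delete-here : ∀ {m} (w : Vec ℕ m) → delete (p ∷ w) ≡ w
  delete-here [] = refl
  delete-here (y ∷ w) with p ≟ p
  ... | yes _ = refl
  ... | no p≢p = ⊥-elim (p≢p refl)

  delete-there : ∀ {m} {x} (w : Vec ℕ (suc m)) → x ≢ p → delete (x ∷ w) ≡ x ∷ delete w
  delete-there {x = x} (y ∷ w) x≢p with x ≟ p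
  ... | yes x≡p = ⊥-elim (x≢p x≡p)
  ... | no _ = refl

  delete-insert : ∀ {m} (v : Vec ℕ m) → delete (insert v) ≡ v
  delete-insert [] = refl
  delete-insert (x ∷ xs) with p ≤? x
  ... | yes _ = delete-here (x ∷ xs)
  ... | no p≰x = trans (delete-there (insert xs) λ { refl → p≰x ≤-refl })
                       (cong (x ∷_) (delete-insert xs))

  insert-injective : ∀ {m} {v w : Vec ℕ m} → insert v ≡ insert w → v ≡ w
  insert-injective {v = v} {w} eq =
    trans (sym (delete-insert v)) (trans (cong delete eq) (delete-insert w))

  0<occ-tail : ∀ {m} {x} (w : Vec ℕ m) → x ≢ p → 0 < occ p (x ∷ w) → 0 < occ p w
  0<occ-tail w x≢p = subst (0 <_) (occ-there w x≢p)

  head≤p : ∀ {m} x (w : Vec ℕ m) → NonDecr (x ∷ w) → 0 < occ p w → x ≤ p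
  head≤p x (y ∷ w) (x≤y , sorted) p∈w with y ≟ p
  ... | yes refl = x≤y
  ... | no y≢p = ≤-trans x≤y (head≤p y w sorted (0<occ-tail w y≢p p∈w))

  insert-delete : ∀ {m} (w : Vec ℕ (suc m)) → NonDecr w → 0 < occ p w → insert (delete w) ≡ w
  insert-delete (x ∷ []) _ p∈w with x ≟ p
  ... | yes refl = refl
  ... | no x≢p with () ← 0<occ-tail [] x≢p p∈w
  insert-delete (x ∷ y ∷ ys) (x≤y , sorted) p∈w with x ≟ p
  insert-delete (x ∷ y ∷ ys) (x≤y , sorted) p∈w | yes refl with p ≤? y
  ... | yes _ = refl
  ... | no p≰y = ⊥-elim (p≰y x≤y)
  insert-delete (x ∷ y ∷ ys) (x≤y , sorted) p∈w | no x≢p with p ≤? x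
  ... | yes p≤x = ⊥-elim (x≢p (≤-antisym (head≤p x (y ∷ ys) (x≤y , sorted) p∈tail) p≤x))
    where
    p∈tail : 0 < occ p (y ∷ ys)
    p∈tail = 0<occ-tail (y ∷ ys) x≢p p∈w
  ... | no _ = cong (x ∷_) (insert-delete (y ∷ ys) sorted (0<occ-tail (y ∷ ys) x≢p p∈w))

  sum-insert : ∀ {m} (v : Vec ℕ m) → sum (insert v) ≡ p + sum v
  sum-insert [] = refl
  sum-insert (x ∷ xs) with p ≤? x
  ... | yes _ = refl
  ... | no _ = trans (cong (x +_) (sum-insert xs)) (x∙yz≈y∙xz x p (sum xs))

  occ-insert : ∀ {m} (v : Vec ℕ m) → occ p (insert v) ≡ suc (occ p v)
  occ-insert [] = occ-here []
  occ-insert (x ∷ xs) with p ≤? x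
  ... | yes _ = occ-here (x ∷ xs)
  ... | no p≰x = begin
    occ p (x ∷ insert xs) ≡⟨ occ-there (insert xs) x≢p ⟩
    occ p (insert xs)     ≡⟨ occ-insert xs ⟩
    suc (occ p xs)        ≡⟨ cong suc (occ-there xs x≢p) ⟨
    suc (occ p (x ∷ xs))  ∎
    where
    open ≡-Reasoning
    x≢p : x ≢ p
    x≢p refl = p≰x ≤-refl

  All-insert : ∀ {P : ℕ → Set} {m} → P p → (v : Vec ℕ m) → All P v → All P (insert v)
  All-insert Pp [] [] = Pp ∷ []
  All-insert Pp (x ∷ xs) (Px ∷ Pxs) with p ≤? x
  ... | yes _ = Pp ∷ Px ∷ Pxs
  ... | no _ = Px ∷ All-insert Pp xs Pxs

  NonDecr-∷-insert : ∀ {m} x (v : Vec ℕ m) → NonDecr (x ∷ v) → x ≤ p → NonDecr (x ∷ insert v)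
  NonDecr-∷-insert x [] _ x≤p = x≤p , tt
  NonDecr-∷-insert x (y ∷ ys) (x≤y , sorted) x≤p with p ≤? y
  ... | yes p≤y = x≤p , p≤y , sorted
  ... | no p≰y = x≤y , NonDecr-∷-insert y ys sorted (<⇒≤ (≰⇒> p≰y))

  NonDecr-insert : ∀ {m} (v : Vec ℕ m) → NonDecr v → NonDecr (insert v)
  NonDecr-insert [] _ = tt
  NonDecr-insert (x ∷ xs) sorted with p ≤? x
  ... | yes p≤x = p≤x , sorted
  ... | no p≰x = NonDecr-∷-insert x xs sorted (<⇒≤ (≰⇒> p≰x))

  All-delete : ∀ {P : ℕ → Set} {m} (w : Vec ℕ (suc m)) → All P w → All P (delete w)
  All-delete (x ∷ []) _ = []
  All-delete (x ∷ y ∷ xs) (Px ∷ Pys) with x ≟ p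
  ... | yes _ = Pys
  ... | no _ = Px ∷ All-delete (y ∷ xs) Pys

  NonDecr-∷-delete : ∀ {m} x (w : Vec ℕ (suc m)) → NonDecr (x ∷ w) → NonDecr (x ∷ delete w)
  NonDecr-∷-delete x (y ∷ []) _ = tt
  NonDecr-∷-delete x (y ∷ z ∷ zs) (x≤y , y≤z , sorted) with y ≟ p
  ... | yes _ = ≤-trans x≤y y≤z , sorted
  ... | no _ = x≤y , NonDecr-∷-delete y (z ∷ zs) (y≤z , sorted)

  NonDecr-delete : ∀ {m} (w : Vec ℕ (suc m)) → NonDecr w → NonDecr (delete w)
  NonDecr-delete (x ∷ []) _ = tt
  NonDecr-delete (x ∷ y ∷ xs) sorted with x ≟ p
  ... | yes _ = proj₂ sorted
  ... | no _ = NonDecr-∷-delete x (y ∷ xs) sorted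

InS-insert : ∀ {p z m v} → Prime p → InS p z m v → InS p (suc z) (suc m) (insert p v)
InS-insert {p} {v = v} p-prime (primes , sorted , sum≡ , occ≡) =
  All-insert p p-prime v primes ,
  NonDecr-insert p v sorted ,
  trans (sum-insert p v) (cong (p +_) sum≡) ,
  trans (occ-insert p v) (cong suc occ≡)

InS-insert-delete : ∀ {p z m w} → InS p (suc z) (suc m) w → insert p (delete p w) ≡ w
InS-insert-delete {p} {w = w} (_ , sorted , _ , occ≡) =
  insert-delete p w sorted (subst (0 <_) (sym occ≡) (s≤s z≤n))

InS-delete : ∀ {p z m w} → InS p (suc z) (suc m) w → InS p z m (delete p w)
InS-delete {p} {z} {m} {w} inS@(primes , sorted , sum≡ , occ≡) =
  All-delete p w primes ,
  NonDecr-delete p w sorted ,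
  +-cancelˡ-≡ p _ _ (begin
    p + sum (delete p w)        ≡⟨ sum-insert p (delete p w) ⟨
    sum (insert p (delete p w)) ≡⟨ cong sum reinsert ⟩
    sum w                       ≡⟨ sum≡ ⟩
    suc m * p                   ∎) ,
  suc-injective (begin
    suc (occ p (delete p w))      ≡⟨ occ-insert p (delete p w) ⟨
    occ p (insert p (delete p w)) ≡⟨ cong (occ p) reinsert ⟩
    occ p w                       ≡⟨ occ≡ ⟩
    suc z                         ∎)
  where
  open ≡-Reasoning
  reinsert : insert p (delete p w) ≡ w
  reinsert = InS-insert-delete inS

solutions : (p z m : ℕ) → List (Vec ℕ m)
solutions p z m = filter (inS? p z m) (allVecs m (suc (m * p)))

solutions-unique : ∀ p z m → Unique (solutions p z m)
solutions-unique p z m = filter⁺ (inS? p z m) (allVecs-unique m (suc (m * p)))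

∈-solutions⁻ : ∀ {p z m} {v : Vec ℕ m} → v ∈ solutions p z m → InS p z m v
∈-solutions⁻ {p} {z} {m} = proj₂ ∘ ∈-filter⁻ (inS? p z m) {xs = allVecs m (suc (m * p))}

∈-solutions⁺ : ∀ {p z m} {v : Vec ℕ m} → InS p z m v → v ∈ solutions p z m
∈-solutions⁺ {p} {z} {m} {v} inS@(_ , _ , sum≡ , _) = ∈-filter⁺ (inS? p z m)
  (allVecs-complete _ v (All-map (λ x≤ → s≤s (subst (_ ≤_) sum≡ x≤)) (All-≤-sum v)))
  inS

map-insert-solutions : ∀ {p} → Prime p → ∀ z m →
  map (insert p) (solutions p z m) ∼[ set ] solutions p (suc z) (suc m)
map-insert-solutions {p} p-prime z m = mk⇔ to from
  where
  to : ∀ {w} → w ∈ map (insert p) (solutions p z m) → w ∈ solutions p (suc z) (suc m)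
  to w∈ with ∈-map⁻ (insert p) w∈
  ... | v , v∈ , refl = ∈-solutions⁺ (InS-insert p-prime (∈-solutions⁻ v∈))
  from : ∀ {w} → w ∈ solutions p (suc z) (suc m) → w ∈ map (insert p) (solutions p z m)
  from {w} w∈ = subst (_∈ _) (InS-insert-delete inS) (∈-map⁺ (insert p) (∈-solutions⁺ (InS-delete inS)))
    where
    inS : InS p (suc z) (suc m) w
    inS = ∈-solutions⁻ w∈

Y-suc : ∀ {p} → Prime p → ∀ z m → Y p z m ≡ Y p (suc z) (suc m)
Y-suc {p} p-prime z m = begin
  length (solutions p z m)                  ≡⟨ length-map (insert p) (solutions p z m) ⟨
  length (map (insert p) (solutions p z m)) ≡⟨ unique-∼set⇒length-≡
                                                  (Unique-map⁺ (insert-injective p) (solutions-unique p z m))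
                                                  (solutions-unique p (suc z) (suc m))
                                                  (map-insert-solutions p-prime z m) ⟩
  length (solutions p (suc z) (suc m))      ∎
  where open ≡-Reasoning

theorem3 : (n m p : ℕ) → 1 < n → 1 < m → m < n → Prime p → n ≡ m * p →
    Σ (Vec ℕ m) (λ v → All Prime v × sum v ≡ n)
    × ((z : ℕ) → Y p z m ≡ Y p (z + 1) (m + 1))
theorem3 n m p _ _ _ p-prime n≡m*p =
  (replicate m p , All-replicate m p-prime , trans (sum-replicate m p) (sym n≡m*p)) ,
  λ z → subst₂ (λ z′ m′ → Y p z m ≡ Y p z′ m′) (+-comm 1 z) (+-comm 1 m) (Y-suc p-prime z m)
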